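{- If $A$ is a proper and non-constant $\alpha$-formula, then there exist an $I$-free $\alpha$-formula $A'$ and an invertible term $f\colon A\vdash A'$.
   Context: Formulae are built from an infinite set of propositional letters and a constant $I$ using binary connectives $\otimes$ and $\to$. An $\alpha$-formula is a formula considered up to strict associativity of $\otimes$ and strict unitality of $I$ ($A\otimes(B\otimes C)=(A\otimes B)\otimes C$, $A\otimes I=I\otimes A=A$, also inside subformulae). An $\alpha$-formula is constant if it contains no letters, $I$-free if it contains no occurrence of $I$, and proper if it has no subformula $B\to C$ with $C$ constant and $B$ not constant. Terms with types $f\colon A\vdash B$: primitive $\mathbf 1_A\colon A\vdash A$, $c_{B,A}\colon B\otimes A\vdash A\otimes B$, $\eta_{A,B}\colon B\vdash A\to(A\otimes B)$, $\varepsilon_{A,B}\colon A\otimes(A\to B)\vdash B$; closed under $g\circ f$ (for $f\colon A\vdash B$, $g\colon B\vdash C$), $f_1\otimes f_2\colon A_1\otimes A_2\vdash B_1\otimes B_2$, and $A\to f\colon A\to B_1\vdash A\to B_2$ (for $f\colon B_1\vdash B_2$); strictly $f\otimes(g\otimes h)=(f\otimes g)\otimes h$, $f\otimes\mathbf 1_I=\mathbf 1_I\otimes f=f$. Equality of terms is the smallest congruence (only between terms of the same type) containing: $g\circ\mathbf 1_A=g$, $\mathbf 1_A\circ f=f$; $h\circ(g\circ f)=(h\circ g)\circ f$; $\mathbf 1_A\otimes\mathbf 1_B=\mathbf 1_{A\otimes B}$; $(g_1\otimes g_2)\circ(f_1\otimes f_2)=(g_1\circ f_1)\otimes(g_2\circ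 f_2)$; $c_{A',B'}\circ(f\otimes g)=(g\otimes f)\circ c_{A,B}$ ($f\colon A\vdash A'$, $g\colon B\vdash B'$); $c_{B,A}\circ c_{A,B}=\mathbf 1_{A\otimes B}$; $c_{A\otimes B,C}=(c_{A,C}\otimes\mathbf 1_B)\circ(\mathbf 1_A\otimes c_{B,C})$; $A\to(g\circ f)=(A\to g)\circ(A\to f)$; $\eta_{A,B'}\circ f=(A\to(\mathbf 1_A\otimes f))\circ\eta_{A,B}$ ($f\colon B\vdash B'$); $A\to\mathbf 1_B=\mathbf 1_{A\to B}$; $\varepsilon_{A,B'}\circ(\mathbf 1_A\otimes(A\to f))=f\circ\varepsilon_{A,B}$ ($f\colon B\vdash B'$); $\varepsilon_{A,A\otimes B}\circ(\mathbf 1_A\otimes\eta_{A,B})=\mathbf 1_{A\otimes B}$; $(A\to\varepsilon_{A,B})\circ\eta_{A,A\to B}=\mathbf 1_{A\to B}$. A term $f\colon A\vdash B$ is invertible if there is a term $g\colon B\vdash A$ with $g\circ f=\mathbf 1_A$ and $f\circ g=\mathbf 1_B$. -}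

module Defs where

open import Data.Nat using (ℕ)
open import Data.List using (List; []; _∷_; [_]; _++_)
open import Data.Product using (Σ; _×_)
open import Data.Empty using (⊥)
open import Relation.Nullary using (¬_)

-- α-formulae, represented by their normal forms.
-- Modulo strict associativity and unitality of ⊗ (also inside
-- subformulae), an α-formula is exactly a finite list of "factors",
-- each factor being a letter or an implication between α-formulae.

data Factor : Set where
  var : ℕ → Factor
  _⇒_ : List Factor → List Factor → Factor

Form : Set
Form = List Factor

I : Form
I = []

infixr 6 _⊗_
_⊗_ : Form → Form → Form
_⊗_ = _++_

_⟶_ : Form → Form → Form
A ⟶ B = [ A ⇒ B ]

mutual
  data ConstF : Factor → Set where
    imp : ∀ {B C} → Const B → Const C → ConstF (B ⇒ C)

  data Const : Form → Set where
    []  : Const []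
    _∷_ : ∀ {x A} → ConstF x → Const A → Const (x ∷ A)

-- I-free: contains no occurrence of I (the normal form is not I and
-- no side of an implication is I, at any depth)
mutual
  data IFreeF : Factor → Set where
    var : ∀ n → IFreeF (var n)
    imp : ∀ {B C} → IFree B → IFree C → IFreeF (B ⇒ C)

  data IFreeL : Form → Set where
    []  : IFreeL []
    _∷_ : ∀ {x A} → IFreeF x → IFreeL A → IFreeL (x ∷ A)

  data IFree : Form → Set where
    nonempty : ∀ {x A} → IFreeF x → IFreeL A → IFree (x ∷ A)

mutual
  data ProperF : Factor → Set where
    var : ∀ n → ProperF (var n)
    imp : ∀ {B C} → Proper B → Proper C →
          ¬ (Const C × ¬ Const B) → ProperF (B ⇒ C)

  data Proper : Form → Set where
    []  : Proper []
    _∷_ : ∀ {x A} → ProperF x → Proper A → Proper (x ∷ A)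

infixr 9 _∘_
infixr 7 _⊗ᵗ_
data Term : Set where
  𝟏    : Form → Term
  c    : Form → Form → Term
  η    : Form → Form → Term
  ε    : Form → Form → Term
  _∘_  : Term → Term → Term
  _⊗ᵗ_ : Term → Term → Term
  _⇒ᵗ_ : Form → Term → Term

infix 4 _∶_⊢_
data _∶_⊢_ : Term → Form → Form → Set where
  t𝟏 : ∀ A → 𝟏 A ∶ A ⊢ A
  tc : ∀ B A → c B A ∶ B ⊗ A ⊢ A ⊗ B
  tη : ∀ A B → η A B ∶ B ⊢ (A ⟶ (A ⊗ B))
  tε : ∀ A B → ε A B ∶ A ⊗ (A ⟶ B) ⊢ B
  t∘ : ∀ {f g A B C} → f ∶ A ⊢ B → g ∶ B ⊢ C → (g ∘ f) ∶ A ⊢ C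
  t⊗ : ∀ {f₁ f₂ A₁ A₂ B₁ B₂} → f₁ ∶ A₁ ⊢ B₁ → f₂ ∶ A₂ ⊢ B₂ →
       (f₁ ⊗ᵗ f₂) ∶ A₁ ⊗ A₂ ⊢ B₁ ⊗ B₂
  t⇒ : ∀ {f B₁ B₂} A → f ∶ B₁ ⊢ B₂ → (A ⇒ᵗ f) ∶ (A ⟶ B₁) ⊢ (A ⟶ B₂)

infix 4 _≈_∶_⊢_
data _≈_∶_⊢_ : Term → Term → Form → Form → Set where
  ≈refl  : ∀ {f A B} → f ∶ A ⊢ B → f ≈ f ∶ A ⊢ B
  ≈sym   : ∀ {f g A B} → f ≈ g ∶ A ⊢ B → g ≈ f ∶ A ⊢ B
  ≈trans : ∀ {f g h A B} → f ≈ g ∶ A ⊢ B → g ≈ h ∶ A ⊢ B → f ≈ h ∶ A ⊢ B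
  cong∘ : ∀ {f f' g g' A B C} → f ≈ f' ∶ A ⊢ B → g ≈ g' ∶ B ⊢ C →
          (g ∘ f) ≈ (g' ∘ f') ∶ A ⊢ C
  cong⊗ : ∀ {f₁ f₁' f₂ f₂' A₁ A₂ B₁ B₂} →
          f₁ ≈ f₁' ∶ A₁ ⊢ B₁ → f₂ ≈ f₂' ∶ A₂ ⊢ B₂ →
          (f₁ ⊗ᵗ f₂) ≈ (f₁' ⊗ᵗ f₂') ∶ A₁ ⊗ A₂ ⊢ B₁ ⊗ B₂
  cong⇒ : ∀ {f f' B₁ B₂} A → f ≈ f' ∶ B₁ ⊢ B₂ →
          (A ⇒ᵗ f) ≈ (A ⇒ᵗ f') ∶ (A ⟶ B₁) ⊢ (A ⟶ B₂)
  ⊗-assoc : ∀ {f g h A₁ A₂ A₃ B₁ B₂ B₃} →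
            f ∶ A₁ ⊢ B₁ → g ∶ A₂ ⊢ B₂ → h ∶ A₃ ⊢ B₃ →
            (f ⊗ᵗ (g ⊗ᵗ h)) ≈ ((f ⊗ᵗ g) ⊗ᵗ h) ∶ A₁ ⊗ A₂ ⊗ A₃ ⊢ B₁ ⊗ B₂ ⊗ B₃
  ⊗-unitʳ : ∀ {f A B} → f ∶ A ⊢ B → (f ⊗ᵗ 𝟏 I) ≈ f ∶ A ⊢ B
  ⊗-unitˡ : ∀ {f A B} → f ∶ A ⊢ B → (𝟏 I ⊗ᵗ f) ≈ f ∶ A ⊢ B
  idʳ : ∀ {g A B} → g ∶ A ⊢ B → (g ∘ 𝟏 A) ≈ g ∶ A ⊢ B
  idˡ : ∀ {f A B} → f ∶ A ⊢ B → (𝟏 B ∘ f) ≈ f ∶ A ⊢ B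
  ∘-assoc : ∀ {f g h A B C D} → f ∶ A ⊢ B → g ∶ B ⊢ C → h ∶ C ⊢ D →
            (h ∘ (g ∘ f)) ≈ ((h ∘ g) ∘ f) ∶ A ⊢ D
  ⊗-id : ∀ A B → (𝟏 A ⊗ᵗ 𝟏 B) ≈ 𝟏 (A ⊗ B) ∶ A ⊗ B ⊢ A ⊗ B
  ⊗-∘  : ∀ {f₁ f₂ g₁ g₂ A₁ A₂ B₁ B₂ C₁ C₂} →
         f₁ ∶ A₁ ⊢ B₁ → g₁ ∶ B₁ ⊢ C₁ → f₂ ∶ A₂ ⊢ B₂ → g₂ ∶ B₂ ⊢ C₂ →
         ((g₁ ⊗ᵗ g₂) ∘ (f₁ ⊗ᵗ f₂)) ≈ ((g₁ ∘ f₁) ⊗ᵗ (g₂ ∘ f₂))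
           ∶ A₁ ⊗ A₂ ⊢ C₁ ⊗ C₂
  c-nat : ∀ {f g A A' B B'} → f ∶ A ⊢ A' → g ∶ B ⊢ B' →
          (c A' B' ∘ (f ⊗ᵗ g)) ≈ ((g ⊗ᵗ f) ∘ c A B) ∶ A ⊗ B ⊢ B' ⊗ A'
  c-inv : ∀ A B → (c B A ∘ c A B) ≈ 𝟏 (A ⊗ B) ∶ A ⊗ B ⊢ A ⊗ B
  c-hex : ∀ A B C → c (A ⊗ B) C ≈ ((c A C ⊗ᵗ 𝟏 B) ∘ (𝟏 A ⊗ᵗ c B C))
                      ∶ (A ⊗ B) ⊗ C ⊢ C ⊗ (A ⊗ B)
  ⇒-∘  : ∀ {f g B₁ B₂ B₃} A → f ∶ B₁ ⊢ B₂ → g ∶ B₂ ⊢ B₃ →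
         (A ⇒ᵗ (g ∘ f)) ≈ ((A ⇒ᵗ g) ∘ (A ⇒ᵗ f)) ∶ (A ⟶ B₁) ⊢ (A ⟶ B₃)
  η-nat : ∀ {f B B'} A → f ∶ B ⊢ B' →
          (η A B' ∘ f) ≈ ((A ⇒ᵗ (𝟏 A ⊗ᵗ f)) ∘ η A B) ∶ B ⊢ (A ⟶ (A ⊗ B'))
  ⇒-id : ∀ A B → (A ⇒ᵗ 𝟏 B) ≈ 𝟏 (A ⟶ B) ∶ (A ⟶ B) ⊢ (A ⟶ B)
  ε-nat : ∀ {f B B'} A → f ∶ B ⊢ B' →
          (ε A B' ∘ (𝟏 A ⊗ᵗ (A ⇒ᵗ f))) ≈ (f ∘ ε A B) ∶ A ⊗ (A ⟶ B) ⊢ B'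
  tri₁ : ∀ A B → (ε A (A ⊗ B) ∘ (𝟏 A ⊗ᵗ η A B)) ≈ 𝟏 (A ⊗ B) ∶ A ⊗ B ⊢ A ⊗ B
  tri₂ : ∀ A B → ((A ⇒ᵗ ε A B) ∘ η A (A ⟶ B)) ≈ 𝟏 (A ⟶ B)
                   ∶ (A ⟶ B) ⊢ (A ⟶ B)

Invertible : Term → Form → Form → Set
Invertible f A B =
  Σ Term λ g → (g ∶ B ⊢ A) × ((g ∘ f) ≈ 𝟏 A ∶ A ⊢ A) × ((f ∘ g) ≈ 𝟏 B ∶ B ⊢ B)

{-# OPTIONS --safe #-}
-- Occurrences of I are eliminated bottom-up.  Under ⊗ they vanish by strictness;
-- an antecedent I is removed by the isomorphism ε : I ⟶ C ≅ C : η; and a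
-- consequent I only occurs, in a proper formula, below a constant antecedent B,
-- where B ⟶ I ≅ I ⟶ I ≅ I.  These isomorphisms propagate through ⊗ and through
-- both arguments of ⟶ (contravariantly in the first, by currying ε ∘ (g ⊗ 𝟏)),
-- and the resulting I-free formula is empty exactly when the input is constant.
module Submission where

open import Data.Empty using (⊥-elim)
open import Data.List using ([]; _∷_; [_]; _++_)
open import Data.List.Properties using (++-conicalˡ; ++-conicalʳ)
open import Data.Product using (Σ; _×_; _,_)
open import Function using (_∘′_)
open import Relation.Binary.Bundles using (PartialSetoid)
open import Relation.Binary.PropositionalEquality using (_≡_; _≢_; refl; sym; trans; cong₂)
open import Relation.Nullary using (¬_)
import Relation.Binary.Reasoning.PartialSetoid as PartialSetoidReasoning

open import Defs

variable
  A A′ A″ B B′ C C′ X Y : Form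
  A₁ A₂ B₁ B₂ : Form
  x : Factor
  f g h k : Term

-- Only partial: ≈refl requires a typing derivation.
Hom : Form → Form → PartialSetoid _ _
Hom A B = record
  { Carrier = Term
  ; _≈_ = λ f g → f ≈ g ∶ A ⊢ B
  ; isPartialEquivalence = record { sym = ≈sym ; trans = ≈trans }
  }

module ≈-Reasoning {A B : Form} = PartialSetoidReasoning (Hom A B)
open ≈-Reasoning

∘-congˡ : h ∶ B ⊢ C → f ≈ g ∶ A ⊢ B → (h ∘ f) ≈ (h ∘ g) ∶ A ⊢ C
∘-congˡ ⊢h f≈g = cong∘ f≈g (≈refl ⊢h)

∘-congʳ : h ∶ A ⊢ B → f ≈ g ∶ B ⊢ C → (f ∘ h) ≈ (g ∘ h) ∶ A ⊢ C
∘-congʳ ⊢h f≈g = cong∘ (≈refl ⊢h) f≈g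

∘-cancel-middle : f ∶ A ⊢ B → g ∶ B ⊢ C → h ∶ C ⊢ B → k ∶ B ⊢ X →
  (h ∘ g) ≈ 𝟏 B ∶ B ⊢ B → ((k ∘ h) ∘ (g ∘ f)) ≈ (k ∘ f) ∶ A ⊢ X
∘-cancel-middle {f = f} {B = B} {g = g} {h = h} {k = k} ⊢f ⊢g ⊢h ⊢k h∘g≈𝟏 = begin
  (k ∘ h) ∘ (g ∘ f)  ≈˘⟨ ∘-assoc (t∘ ⊢f ⊢g) ⊢h ⊢k ⟩
  k ∘ (h ∘ (g ∘ f))  ≈⟨ ∘-congˡ ⊢k (∘-assoc ⊢f ⊢g ⊢h) ⟩
  k ∘ ((h ∘ g) ∘ f)  ≈⟨ ∘-congˡ ⊢k (∘-congʳ ⊢f h∘g≈𝟏) ⟩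
  k ∘ (𝟏 B ∘ f)      ≈⟨ ∘-congˡ ⊢k (idˡ ⊢f) ⟩
  k ∘ f              ∎

⊗-interchange : f ∶ A₁ ⊢ B₁ → g ∶ A₂ ⊢ B₂ →
  ((f ⊗ᵗ 𝟏 B₂) ∘ (𝟏 A₁ ⊗ᵗ g)) ≈ ((𝟏 B₁ ⊗ᵗ g) ∘ (f ⊗ᵗ 𝟏 A₂)) ∶ A₁ ⊗ A₂ ⊢ B₁ ⊗ B₂
⊗-interchange {f = f} {A₁ = A₁} {B₁ = B₁} {g = g} {A₂ = A₂} {B₂ = B₂} ⊢f ⊢g = begin
  (f ⊗ᵗ 𝟏 B₂) ∘ (𝟏 A₁ ⊗ᵗ g)  ≈⟨ ⊗-∘ (t𝟏 A₁) ⊢f ⊢g (t𝟏 B₂) ⟩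
  (f ∘ 𝟏 A₁) ⊗ᵗ (𝟏 B₂ ∘ g)   ≈⟨ cong⊗ (idʳ ⊢f) (idˡ ⊢g) ⟩
  f ⊗ᵗ g                     ≈˘⟨ cong⊗ (idˡ ⊢f) (idʳ ⊢g) ⟩
  (𝟏 B₁ ∘ f) ⊗ᵗ (g ∘ 𝟏 A₂)   ≈˘⟨ ⊗-∘ ⊢f (t𝟏 B₁) (t𝟏 A₂) ⊢g ⟩
  (𝟏 B₁ ⊗ᵗ g) ∘ (f ⊗ᵗ 𝟏 A₂)  ∎

curry : Form → Form → Term → Term
curry A X h = (A ⇒ᵗ h) ∘ η A X

⊢curry : h ∶ A ⊗ X ⊢ C → curry A X h ∶ X ⊢ (A ⟶ C)
⊢curry {A = A} {X = X} ⊢h = t∘ (tη A X) (t⇒ A ⊢h)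

curry-cong : h ≈ k ∶ A ⊗ X ⊢ C → curry A X h ≈ curry A X k ∶ X ⊢ (A ⟶ C)
curry-cong {A = A} {X = X} h≈k = ∘-congʳ (tη A X) (cong⇒ A h≈k)

ε∘curry : h ∶ A ⊗ X ⊢ C → (ε A C ∘ (𝟏 A ⊗ᵗ curry A X h)) ≈ h ∶ A ⊗ X ⊢ C
ε∘curry {h = h} {A = A} {X = X} {C = C} ⊢h = begin
  ε A C ∘ (𝟏 A ⊗ᵗ ((A ⇒ᵗ h) ∘ η A X))
    ≈˘⟨ ∘-congˡ (tε A C) (cong⊗ (idˡ (t𝟏 A)) (≈refl (⊢curry ⊢h))) ⟩
  ε A C ∘ ((𝟏 A ∘ 𝟏 A) ⊗ᵗ ((A ⇒ᵗ h) ∘ η A X))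
    ≈˘⟨ ∘-congˡ (tε A C) (⊗-∘ (t𝟏 A) (t𝟏 A) (tη A X) (t⇒ A ⊢h)) ⟩
  ε A C ∘ ((𝟏 A ⊗ᵗ (A ⇒ᵗ h)) ∘ (𝟏 A ⊗ᵗ η A X))
    ≈⟨ ∘-assoc ⊢𝟏⊗η (t⊗ (t𝟏 A) (t⇒ A ⊢h)) (tε A C) ⟩
  (ε A C ∘ (𝟏 A ⊗ᵗ (A ⇒ᵗ h))) ∘ (𝟏 A ⊗ᵗ η A X)
    ≈⟨ ∘-congʳ ⊢𝟏⊗η (ε-nat A ⊢h) ⟩
  (h ∘ ε A (A ⊗ X)) ∘ (𝟏 A ⊗ᵗ η A X)
    ≈˘⟨ ∘-assoc ⊢𝟏⊗η (tε A (A ⊗ X)) ⊢h ⟩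
  h ∘ (ε A (A ⊗ X) ∘ (𝟏 A ⊗ᵗ η A X))
    ≈⟨ ∘-congˡ ⊢h (tri₁ A X) ⟩
  h ∘ 𝟏 (A ⊗ X)
    ≈⟨ idʳ ⊢h ⟩
  h ∎
  where ⊢𝟏⊗η = t⊗ (t𝟏 A) (tη A X)

curry∘ : h ∶ A ⊗ Y ⊢ C → k ∶ X ⊢ Y →
  (curry A Y h ∘ k) ≈ curry A X (h ∘ (𝟏 A ⊗ᵗ k)) ∶ X ⊢ (A ⟶ C)
curry∘ {h = h} {A = A} {Y = Y} {k = k} {X = X} ⊢h ⊢k = begin
  ((A ⇒ᵗ h) ∘ η A Y) ∘ k                ≈˘⟨ ∘-assoc ⊢k (tη A Y) (t⇒ A ⊢h) ⟩
  (A ⇒ᵗ h) ∘ (η A Y ∘ k)                ≈⟨ ∘-congˡ (t⇒ A ⊢h) (η-nat A ⊢k) ⟩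
  (A ⇒ᵗ h) ∘ ((A ⇒ᵗ 𝟏⊗k) ∘ η A X)       ≈⟨ ∘-assoc (tη A X) (t⇒ A ⊢𝟏⊗k) (t⇒ A ⊢h) ⟩
  ((A ⇒ᵗ h) ∘ (A ⇒ᵗ 𝟏⊗k)) ∘ η A X       ≈˘⟨ ∘-congʳ (tη A X) (⇒-∘ A ⊢𝟏⊗k ⊢h) ⟩
  (A ⇒ᵗ (h ∘ 𝟏⊗k)) ∘ η A X              ∎
  where
    𝟏⊗k = 𝟏 A ⊗ᵗ k
    ⊢𝟏⊗k = t⊗ (t𝟏 A) ⊢k

precomp : Form → Form → Form → Term → Term
precomp A′ A C g = curry A′ (A ⟶ C) (ε A C ∘ (g ⊗ᵗ 𝟏 (A ⟶ C)))

⊢precomp : ∀ C → g ∶ A′ ⊢ A → precomp A′ A C g ∶ (A ⟶ C) ⊢ (A′ ⟶ C)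
⊢precomp {A = A} C ⊢g = ⊢curry (t∘ (t⊗ ⊢g (t𝟏 (A ⟶ C))) (tε A C))

precomp-cong : ∀ C → g ≈ h ∶ A′ ⊢ A →
  precomp A′ A C g ≈ precomp A′ A C h ∶ (A ⟶ C) ⊢ (A′ ⟶ C)
precomp-cong {A = A} C g≈h =
  curry-cong (∘-congˡ (tε A C) (cong⊗ g≈h (≈refl (t𝟏 (A ⟶ C)))))

precomp-id : ∀ A C → precomp A A C (𝟏 A) ≈ 𝟏 (A ⟶ C) ∶ (A ⟶ C) ⊢ (A ⟶ C)
precomp-id A C = begin
  curry A (A ⟶ C) (ε A C ∘ (𝟏 A ⊗ᵗ 𝟏 (A ⟶ C)))
    ≈⟨ curry-cong (∘-congˡ (tε A C) (⊗-id A (A ⟶ C))) ⟩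
  curry A (A ⟶ C) (ε A C ∘ 𝟏 (A ⊗ (A ⟶ C)))
    ≈⟨ curry-cong (idʳ (tε A C)) ⟩
  curry A (A ⟶ C) (ε A C)
    ≈⟨ tri₂ A C ⟩
  𝟏 (A ⟶ C) ∎

precomp-∘ : ∀ C → g ∶ A′ ⊢ A → h ∶ A″ ⊢ A′ →
  (precomp A″ A′ C h ∘ precomp A′ A C g) ≈ precomp A″ A C (g ∘ h) ∶ (A ⟶ C) ⊢ (A″ ⟶ C)
precomp-∘ {g = g} {A′ = A′} {A = A} {h = h} {A″ = A″} C ⊢g ⊢h = begin
  precomp A″ A′ C h ∘ P
    ≈⟨ curry∘ (t∘ (t⊗ ⊢h (t𝟏 A′⟶C)) (tε A′ C)) ⊢P ⟩
  curry A″ A⟶C ((ε A′ C ∘ (h ⊗ᵗ 𝟏 A′⟶C)) ∘ (𝟏 A″ ⊗ᵗ P))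
    ≈⟨ curry-cong uncurried ⟩
  precomp A″ A C (g ∘ h) ∎
  where
    A⟶C = A ⟶ C
    A′⟶C = A′ ⟶ C
    P = precomp A′ A C g
    ⊢P = ⊢precomp C ⊢g
    uncurried : ((ε A′ C ∘ (h ⊗ᵗ 𝟏 A′⟶C)) ∘ (𝟏 A″ ⊗ᵗ P))
              ≈ (ε A C ∘ ((g ∘ h) ⊗ᵗ 𝟏 A⟶C)) ∶ A″ ⊗ A⟶C ⊢ C
    uncurried = begin
      (ε A′ C ∘ (h ⊗ᵗ 𝟏 A′⟶C)) ∘ (𝟏 A″ ⊗ᵗ P)
        ≈˘⟨ ∘-assoc (t⊗ (t𝟏 A″) ⊢P) (t⊗ ⊢h (t𝟏 A′⟶C)) (tε A′ C) ⟩
      ε A′ C ∘ ((h ⊗ᵗ 𝟏 A′⟶C) ∘ (𝟏 A″ ⊗ᵗ P))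
        ≈⟨ ∘-congˡ (tε A′ C) (⊗-interchange ⊢h ⊢P) ⟩
      ε A′ C ∘ ((𝟏 A′ ⊗ᵗ P) ∘ (h ⊗ᵗ 𝟏 A⟶C))
        ≈⟨ ∘-assoc (t⊗ ⊢h (t𝟏 A⟶C)) (t⊗ (t𝟏 A′) ⊢P) (tε A′ C) ⟩
      (ε A′ C ∘ (𝟏 A′ ⊗ᵗ P)) ∘ (h ⊗ᵗ 𝟏 A⟶C)
        ≈⟨ ∘-congʳ (t⊗ ⊢h (t𝟏 A⟶C)) (ε∘curry (t∘ (t⊗ ⊢g (t𝟏 A⟶C)) (tε A C))) ⟩
      (ε A C ∘ (g ⊗ᵗ 𝟏 A⟶C)) ∘ (h ⊗ᵗ 𝟏 A⟶C)
        ≈˘⟨ ∘-assoc (t⊗ ⊢h (t𝟏 A⟶C)) (t⊗ ⊢g (t𝟏 A⟶C)) (tε A C) ⟩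
      ε A C ∘ ((g ⊗ᵗ 𝟏 A⟶C) ∘ (h ⊗ᵗ 𝟏 A⟶C))
        ≈⟨ ∘-congˡ (tε A C) (⊗-∘ ⊢h ⊢g (t𝟏 A⟶C) (t𝟏 A⟶C)) ⟩
      ε A C ∘ ((g ∘ h) ⊗ᵗ (𝟏 A⟶C ∘ 𝟏 A⟶C))
        ≈⟨ ∘-congˡ (tε A C) (cong⊗ (≈refl (t∘ ⊢h ⊢g)) (idˡ (t𝟏 A⟶C))) ⟩
      ε A C ∘ ((g ∘ h) ⊗ᵗ 𝟏 A⟶C) ∎

infix 4 _≅_
record _≅_ (A B : Form) : Set where
  field
    to from : Term
    ⊢to : to ∶ A ⊢ B
    ⊢from : from ∶ B ⊢ A
    from∘to : (from ∘ to) ≈ 𝟏 A ∶ A ⊢ A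
    to∘from : (to ∘ from) ≈ 𝟏 B ∶ B ⊢ B

≅-refl : A ≅ A
≅-refl {A} = record
  { ⊢to = t𝟏 A ; ⊢from = t𝟏 A ; from∘to = idˡ (t𝟏 A) ; to∘from = idˡ (t𝟏 A) }

≅-trans : A ≅ B → B ≅ C → A ≅ C
≅-trans A≅B B≅C = record
  { ⊢to = t∘ (⊢to A≅B) (⊢to B≅C)
  ; ⊢from = t∘ (⊢from B≅C) (⊢from A≅B)
  ; from∘to = ≈trans
      (∘-cancel-middle (⊢to A≅B) (⊢to B≅C) (⊢from B≅C) (⊢from A≅B) (from∘to B≅C))
      (from∘to A≅B)
  ; to∘from = ≈trans
      (∘-cancel-middle (⊢from B≅C) (⊢from A≅B) (⊢to A≅B) (⊢to B≅C) (to∘from A≅B))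
      (to∘from B≅C)
  }
  where open _≅_

⊗-resp-≅ : A₁ ≅ B₁ → A₂ ≅ B₂ → A₁ ⊗ A₂ ≅ B₁ ⊗ B₂
⊗-resp-≅ {A₁} {B₁} {A₂} {B₂} i₁ i₂ = record
  { ⊢to = t⊗ (⊢to i₁) (⊢to i₂)
  ; ⊢from = t⊗ (⊢from i₁) (⊢from i₂)
  ; from∘to = ≈trans (⊗-∘ (⊢to i₁) (⊢from i₁) (⊢to i₂) (⊢from i₂))
                (≈trans (cong⊗ (from∘to i₁) (from∘to i₂)) (⊗-id A₁ A₂))
  ; to∘from = ≈trans (⊗-∘ (⊢from i₁) (⊢to i₁) (⊢from i₂) (⊢to i₂))
                (≈trans (cong⊗ (to∘from i₁) (to∘from i₂)) (⊗-id B₁ B₂))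
  }
  where open _≅_

⟶-respʳ-≅ : ∀ A → C ≅ C′ → (A ⟶ C) ≅ (A ⟶ C′)
⟶-respʳ-≅ {C} {C′} A i = record
  { ⊢to = t⇒ A (⊢to i)
  ; ⊢from = t⇒ A (⊢from i)
  ; from∘to = ≈trans (≈sym (⇒-∘ A (⊢to i) (⊢from i)))
                (≈trans (cong⇒ A (from∘to i)) (⇒-id A C))
  ; to∘from = ≈trans (≈sym (⇒-∘ A (⊢from i) (⊢to i)))
                (≈trans (cong⇒ A (to∘from i)) (⇒-id A C′))
  }
  where open _≅_

⟶-respˡ-≅ : ∀ C → A ≅ A′ → (A ⟶ C) ≅ (A′ ⟶ C)
⟶-respˡ-≅ {A} {A′} C i = record
  { ⊢to = ⊢precomp C (⊢from i)
  ; ⊢from = ⊢precomp C (⊢to i)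
  ; from∘to = ≈trans (precomp-∘ C (⊢from i) (⊢to i))
                (≈trans (precomp-cong C (from∘to i)) (precomp-id A C))
  ; to∘from = ≈trans (precomp-∘ C (⊢to i) (⊢from i))
                (≈trans (precomp-cong C (to∘from i)) (precomp-id A′ C))
  }
  where open _≅_

⟶-unitˡ : ∀ C → (I ⟶ C) ≅ C
⟶-unitˡ C = record
  { ⊢to = tε I C
  ; ⊢from = tη I C
  ; from∘to = begin
      η I C ∘ ε I C                        ≈⟨ η-nat I (tε I C) ⟩
      (I ⇒ᵗ (𝟏 I ⊗ᵗ ε I C)) ∘ η I (I ⟶ C)  ≈⟨ ∘-congʳ (tη I (I ⟶ C)) (cong⇒ I (⊗-unitˡ (tε I C))) ⟩
      (I ⇒ᵗ ε I C) ∘ η I (I ⟶ C)           ≈⟨ tri₂ I C ⟩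
      𝟏 (I ⟶ C)                            ∎
  ; to∘from = begin
      ε I C ∘ η I C                        ≈˘⟨ ∘-congˡ (tε I C) (⊗-unitˡ (tη I C)) ⟩
      ε I C ∘ (𝟏 I ⊗ᵗ η I C)               ≈⟨ tri₁ I C ⟩
      𝟏 C                                  ∎
  }

-- The clause B ⟶ₛ I = I is only sound because properness makes B constant there.
infixr 5 _⟶ₛ_
_⟶ₛ_ : Form → Form → Form
[] ⟶ₛ C = C
(_ ∷ _) ⟶ₛ [] = []
B@(_ ∷ _) ⟶ₛ C@(_ ∷ _) = B ⟶ C

mutual
  elimI : Form → Form
  elimI [] = []
  elimI (x ∷ A) = elimIF x ++ elimI A

  elimIF : Factor → Form
  elimIF (var n) = [ var n ]
  elimIF (B ⇒ C) = elimI B ⟶ₛ elimI C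

∷≢[] : x ∷ A ≢ I
∷≢[] ()

IFreeL⇒IFree : IFreeL A → A ≢ I → IFree A
IFreeL⇒IFree [] A≢I = ⊥-elim (A≢I refl)
IFreeL⇒IFree (x ∷ xs) _ = nonempty x xs

++-IFreeL : IFreeL A → IFreeL B → IFreeL (A ++ B)
++-IFreeL [] iB = iB
++-IFreeL (x ∷ xs) iB = x ∷ ++-IFreeL xs iB

⟶ₛ-IFreeL : IFreeL B → IFreeL C → IFreeL (B ⟶ₛ C)
⟶ₛ-IFreeL [] iC = iC
⟶ₛ-IFreeL (_ ∷ _) [] = []
⟶ₛ-IFreeL iB@(_ ∷ _) iC@(_ ∷ _) = imp (IFreeL⇒IFree iB ∷≢[]) (IFreeL⇒IFree iC ∷≢[]) ∷ []

⟶ₛ≡I⇒≡I : ∀ B → B ⟶ₛ C ≡ I → C ≡ I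
⟶ₛ≡I⇒≡I [] e = e
⟶ₛ≡I⇒≡I {[]} (_ ∷ _) _ = refl

mutual
  elimI-IFreeL : ∀ A → IFreeL (elimI A)
  elimI-IFreeL [] = []
  elimI-IFreeL (x ∷ A) = ++-IFreeL (elimIF-IFreeL x) (elimI-IFreeL A)

  elimIF-IFreeL : ∀ x → IFreeL (elimIF x)
  elimIF-IFreeL (var n) = var n ∷ []
  elimIF-IFreeL (B ⇒ C) = ⟶ₛ-IFreeL (elimI-IFreeL B) (elimI-IFreeL C)

mutual
  Const⇒elimI≡I : Const A → elimI A ≡ I
  Const⇒elimI≡I [] = refl
  Const⇒elimI≡I (cx ∷ cA) = cong₂ _++_ (ConstF⇒elimIF≡I cx) (Const⇒elimI≡I cA)

  ConstF⇒elimIF≡I : ConstF x → elimIF x ≡ I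
  ConstF⇒elimIF≡I (imp cB cC) = cong₂ _⟶ₛ_ (Const⇒elimI≡I cB) (Const⇒elimI≡I cC)

¬¬Const⇒elimI≡I : ∀ A → ¬ ¬ Const A → elimI A ≡ I
¬¬Const⇒elimI≡I A ¬¬cA with elimI A in eq
... | [] = refl
... | _ ∷ _ = ⊥-elim (¬¬cA λ cA → ∷≢[] (trans (sym eq) (Const⇒elimI≡I cA)))

mutual
  elimI≡I⇒Const : Proper A → elimI A ≡ I → Const A
  elimI≡I⇒Const [] _ = []
  elimI≡I⇒Const {x ∷ A} (px ∷ pA) e =
    elimIF≡I⇒ConstF px (++-conicalˡ (elimIF x) (elimI A) e) ∷
    elimI≡I⇒Const pA (++-conicalʳ (elimIF x) (elimI A) e)

  elimIF≡I⇒ConstF : ProperF x → elimIF x ≡ I → ConstF x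
  elimIF≡I⇒ConstF (imp {B} pB pC np) e =
    imp (elimI≡I⇒Const pB (antecedent-elimI≡I pC np C≡I)) (elimI≡I⇒Const pC C≡I)
    where C≡I = ⟶ₛ≡I⇒≡I (elimI B) e

  antecedent-elimI≡I : Proper C → ¬ (Const C × ¬ Const B) → elimI C ≡ I → elimI B ≡ I
  antecedent-elimI≡I {B = B} pC np e =
    ¬¬Const⇒elimI≡I B (λ ¬cB → np (elimI≡I⇒Const pC e , ¬cB))

⟶ₛ-resp-≅ : B ≅ B′ → C ≅ C′ → (C′ ≡ I → B′ ≡ I) → (B ⟶ C) ≅ (B′ ⟶ₛ C′)
⟶ₛ-resp-≅ {B′ = []} {C = C} {C′ = C′} iB iC _ =
  ≅-trans (⟶-respˡ-≅ C iB) (≅-trans (⟶-respʳ-≅ I iC) (⟶-unitˡ C′))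
⟶ₛ-resp-≅ {B′ = _ ∷ _} {C′ = []} _ _ vanish = ⊥-elim (∷≢[] (vanish refl))
⟶ₛ-resp-≅ {B′ = B′@(_ ∷ _)} {C = C} {C′ = _ ∷ _} iB iC _ =
  ≅-trans (⟶-respˡ-≅ C iB) (⟶-respʳ-≅ B′ iC)

mutual
  ≅-elimI : Proper A → A ≅ elimI A
  ≅-elimI [] = ≅-refl
  ≅-elimI (px ∷ pA) = ⊗-resp-≅ (≅-elimIF px) (≅-elimI pA)

  ≅-elimIF : ProperF x → [ x ] ≅ elimIF x
  ≅-elimIF (var n) = ≅-refl
  ≅-elimIF (imp pB pC np) = ⟶ₛ-resp-≅ (≅-elimI pB) (≅-elimI pC) (antecedent-elimI≡I pC np)

proposition5p5 : (A : Form) → Proper A → ¬ Const A →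
                 Σ Form λ A' → IFree A' ×
                   Σ Term λ f → (f ∶ A ⊢ A') × Invertible f A A'
proposition5p5 A pA ¬cA =
  elimI A , IFreeL⇒IFree (elimI-IFreeL A) (¬cA ∘′ elimI≡I⇒Const pA) ,
  to , ⊢to , from , ⊢from , from∘to , to∘from
  where open _≅_ (≅-elimI pA)
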